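{- Let $N=\prod_{i=1}^n p_i$ be square-free with divisors $d_1<\dots<d_s$ ($s=2^n$) in the total order described in the context, and $d_{ij}:=d_i\boxplus d_j$. Let $\Lambda$ be the $s\times s$ matrix with $\Lambda_{ij}=\frac{1}{24}a_N(d_i,d_j)$, where $a_N(a,b)=\frac{N}{(a,N/a)}\frac{(a,b)^2}{ab}$, and let $A$ be the $s\times s$ matrix $A_{ij}=\mathrm{sgn}(d_{ij})\, d_{ij}$. Then $A=\frac{\varphi(N)\psi(N)}{24}\,\Lambda^{ -1}$ (in particular $\Lambda$ is invertible).
   Context: Each divisor $a$ of $N$ is identified with $(a_1,\dots,a_n)\in\{0,1\}^n$, $a_i=1$ iff $p_i\mid a$. Order: for $a\ne b$, $a<b$ if $\omega(a)<\omega(b)$; if $\omega(a)=\omega(b)$, $a<b$ iff at the first index $t$ with $a_t\ne b_t$ one has $a_t>b_t$. Box addition: $(a\boxplus b)_i\in\{0,1\}$, $\equiv a_i+b_i+1\pmod 2$. $\mathrm{sgn}(a)=(-1)^{\omega(N)-\omega(a)}$, $\omega$ = number of distinct prime factors. $\varphi(N)=\prod(p_i-1)$, $\psi(N)=\prod(p_i+1)$; $(x,y)$ denotes gcd. -}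

module Defs where

open import Data.Bool using (Bool; true; false; if_then_else_; _xor_; not)
open import Data.Nat as ℕ using (ℕ; zero; suc; _∸_)
open import Data.Nat.GCD using (gcd)
open import Data.Fin using (Fin; zero; suc)
open import Data.Vec using (Vec; []; _∷_; zipWith; replicate)
open import Data.Vec.Properties using (≡-dec)
open import Data.List using (List; []; _∷_; map; _++_; foldr)
open import Data.Integer using (+_)
open import Data.Rational using (ℚ; 0ℚ; 1ℚ; _*_; _+_; -_) renaming (_/_ to _/ℚ_)
import Data.Bool.Properties as BoolP
open import Relation.Nullary using (yes; no)

-- Divisors of N = p₁⋯pₙ are identified with their exponent vectors in {0,1}ⁿ.
Div : ℕ → Set
Div n = Vec Bool n

allDivs : (n : ℕ) → List (Div n)
allDivs zero = [] ∷ []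
allDivs (suc n) = map (true ∷_) (allDivs n) ++ map (false ∷_) (allDivs n)

val : ∀ {n} → (Fin n → ℕ) → Div n → ℕ
val {zero} p [] = 1
val {suc n} p (x ∷ a) = (if x then p zero else 1) ℕ.* val (λ i → p (suc i)) a

prodF : ∀ {n} → (Fin n → ℕ) → ℕ
prodF {zero} f = 1
prodF {suc n} f = f zero ℕ.* prodF (λ i → f (suc i))

NN : ∀ {n} → (Fin n → ℕ) → ℕ
NN p = prodF p

φN : ∀ {n} → (Fin n → ℕ) → ℕ
φN p = prodF (λ i → p i ∸ 1)

ψN : ∀ {n} → (Fin n → ℕ) → ℕ
ψN p = prodF (λ i → suc (p i))

ω : ∀ {n} → Div n → ℕ
ω [] = 0
ω (true ∷ a) = suc (ω a)
ω (false ∷ a) = ω a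

negPow : ℕ → ℚ
negPow zero = 1ℚ
negPow (suc k) = - negPow k

sgn : ∀ {n} → Div n → ℚ
sgn {n} a = negPow (n ∸ ω a)

_⊞_ : ∀ {n} → Div n → Div n → Div n
a ⊞ b = zipWith (λ x y → not (x xor y)) a b

-- natural-number quotients (denominators are positive in all uses below;
-- the zero-denominator branch is a harmless totality default)
divℕ : ℕ → ℕ → ℕ
divℕ m zero = 0
divℕ m (suc k) = m ℕ./ suc k

divℚ : ℕ → ℕ → ℚ
divℚ m zero = 0ℚ
divℚ m (suc k) = (+ m) /ℚ suc k

aN : ℕ → ℕ → ℕ → ℚ
aN N a b = divℚ (N ℕ.* (gcd a b ℕ.* gcd a b)) (gcd a (divℕ N a) ℕ.* (a ℕ.* b))

Mat : ℕ → Set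
Mat n = Div n → Div n → ℚ

sumℚ : List ℚ → ℚ
sumℚ = foldr _+_ 0ℚ

_⊗_ : ∀ {n} → Mat n → Mat n → Mat n
_⊗_ {n} M K a b = sumℚ (map (λ c → M a c * K c b) (allDivs n))

idMat : ∀ {n} → Mat n
idMat a b with ≡-dec BoolP._≟_ a b
... | yes _ = 1ℚ
... | no _ = 0ℚ

scal : ∀ {n} → ℚ → Mat n → Mat n
scal c M a b = c * M a b

Λ : ∀ {n} → (Fin n → ℕ) → Mat n
Λ p a b = divℚ 1 24 * aN (NN p) (val p a) (val p b)

AMat : ∀ {n} → (Fin n → ℕ) → Mat n
AMat p a b = sgn (a ⊞ b) * (+ val p (a ⊞ b) /ℚ 1)

{-# OPTIONS --safe #-}
-- Both matrices depend on (a, b) only through c = a ⊞ b, whose i-th coordinate says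
-- whether a and b agree at pᵢ.  Since (a, N/a) = 1 and N (a, b)² = a b c for squarefree
-- divisors, a_N(a, b) is the number c itself; and sgn(c) c = ∏ (pᵢ or -1).  Hence 24 Λ
-- and A are the Kronecker products over i of [[pᵢ, 1], [1, pᵢ]] and [[pᵢ, -1], [-1, pᵢ]],
-- whose products in either order are (pᵢ² - 1) I, and ∏ (pᵢ² - 1) = φ(N) ψ(N).
module Submission where

open import Defs
open import Algebra.Bundles using (CommutativeMonoid)
open import Data.Bool using (Bool; true; false; _∧_; _xor_; not; if_then_else_)
import Data.Bool.Properties as BoolP
open import Data.Empty using (⊥-elim)
open import Data.Fin using (Fin; zero; suc)
open import Data.Fin.Properties using (suc-injective)
import Data.Integer as ℤ
import Data.Integer.Properties as ℤP
open import Data.List as List using (_++_)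
open import Data.List.Properties using (map-++; map-∘; map-cong)
open import Data.Nat using (ℕ; zero; suc; _∸_; NonZero)
import Data.Nat as ℕ
import Data.Nat.Properties as ℕP
open import Data.Nat.Coprimality as Coprimality using (Coprime; coprime-divisor; 1-coprimeTo)
open import Data.Nat.Divisibility using (∣-trans; ∣-antisym; n∣m*n)
open import Data.Nat.DivMod using (m*n/n≡m)
open import Data.Nat.GCD using (gcd; gcd[m,n]∣m; gcd[m,n]∣n; gcd-greatest; gcd-comm; c*gcd[m,n]≡gcd[cm,cn])
open import Data.Nat.Primality using (Prime; prime⇒irreducible; prime⇒nonTrivial; prime⇒nonZero)
import Data.Nat.Tactic.RingSolver as ℕSolver
open import Data.Product using (_×_; _,_)
open import Data.Rational using (ℚ; _+_; _*_; _-_; -_; 0ℚ; 1ℚ; _/_; fromℚᵘ)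
import Data.Rational.Properties as ℚP
import Data.Rational.Unnormalised as ℚᵘ
import Data.Rational.Unnormalised.Properties as ℚᵘP
open import Data.Sum using (inj₁; inj₂)
open import Data.Vec using ([]; _∷_; zipWith; map)
open import Data.Vec.Properties using (≡-dec; ∷-injectiveʳ)
open import Function using (_∘_)
open import Relation.Binary.PropositionalEquality using (_≡_; _≢_; refl; sym; trans; cong; cong₂; module ≡-Reasoning)
open import Relation.Nullary using (Dec; yes; no)
open import Relation.Nullary.Decidable using (dec⇒maybe)
open import Tactic.RingSolver using (solve-∀)
open import Tactic.RingSolver.Core.AlmostCommutativeRing using (AlmostCommutativeRing; fromCommutativeRing)

open import Algebra.Properties.CommutativeSemigroup (CommutativeMonoid.commutativeSemigroup ℚP.*-1-commutativeMonoid)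
  using (interchange; x∙yz≈y∙xz)
open import Algebra.Properties.CommutativeSemigroup ℕP.*-commutativeSemigroup
  using () renaming (interchange to ℕ-interchange)

ℚ-ring : AlmostCommutativeRing _ _
ℚ-ring = fromCommutativeRing ℚP.+-*-commutativeRing (λ x → dec⇒maybe (0ℚ ℚP.≟ x))

ι : ℕ → ℚ
ι m = ℤ.+ m / 1

fromℚᵘ-homo-* : ∀ x y → fromℚᵘ (x ℚᵘ.* y) ≡ fromℚᵘ x * fromℚᵘ y
fromℚᵘ-homo-* x y = ℚP.toℚᵘ-injective
  (ℚᵘP.≃-trans (ℚP.toℚᵘ-fromℚᵘ (x ℚᵘ.* y))
  (ℚᵘP.≃-trans (ℚᵘP.*-cong (ℚᵘP.≃-sym (ℚP.toℚᵘ-fromℚᵘ x)) (ℚᵘP.≃-sym (ℚP.toℚᵘ-fromℚᵘ y)))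
    (ℚᵘP.≃-sym (ℚP.toℚᵘ-homo-* (fromℚᵘ x) (fromℚᵘ y)))))

fromℚᵘ-homo-+ : ∀ x y → fromℚᵘ (x ℚᵘ.+ y) ≡ fromℚᵘ x + fromℚᵘ y
fromℚᵘ-homo-+ x y = ℚP.toℚᵘ-injective
  (ℚᵘP.≃-trans (ℚP.toℚᵘ-fromℚᵘ (x ℚᵘ.+ y))
  (ℚᵘP.≃-trans (ℚᵘP.+-cong (ℚᵘP.≃-sym (ℚP.toℚᵘ-fromℚᵘ x)) (ℚᵘP.≃-sym (ℚP.toℚᵘ-fromℚᵘ y)))
    (ℚᵘP.≃-sym (ℚP.toℚᵘ-homo-+ (fromℚᵘ x) (fromℚᵘ y)))))

ι-homo-* : ∀ m k → ι (m ℕ.* k) ≡ ι m * ι k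
ι-homo-* m k = trans
  (ℚP.fromℚᵘ-cong {ℚᵘ.mkℚᵘ (ℤ.+ (m ℕ.* k)) 0} {ℚᵘ.mkℚᵘ (ℤ.+ m) 0 ℚᵘ.* ℚᵘ.mkℚᵘ (ℤ.+ k) 0}
    (ℚᵘ.*≡* (cong (ℤ._* ℤ.+ 1) (ℤP.pos-* m k))))
  (fromℚᵘ-homo-* (ℚᵘ.mkℚᵘ (ℤ.+ m) 0) (ℚᵘ.mkℚᵘ (ℤ.+ k) 0))

ι-homo-+ : ∀ m k → ι (m ℕ.+ k) ≡ ι m + ι k
ι-homo-+ m k = trans
  (ℚP.fromℚᵘ-cong {ℚᵘ.mkℚᵘ (ℤ.+ (m ℕ.+ k)) 0} {ℚᵘ.mkℚᵘ (ℤ.+ m) 0 ℚᵘ.+ ℚᵘ.mkℚᵘ (ℤ.+ k) 0}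
    (ℚᵘ.*≡* (cong (ℤ._* ℤ.+ 1) (begin
      ℤ.+ (m ℕ.+ k)                         ≡⟨ ℤP.pos-+ m k ⟩
      ℤ.+ m ℤ.+ ℤ.+ k                       ≡⟨ sym (cong₂ ℤ._+_ (ℤP.*-identityʳ (ℤ.+ m)) (ℤP.*-identityʳ (ℤ.+ k))) ⟩
      ℤ.+ m ℤ.* ℤ.+ 1 ℤ.+ ℤ.+ k ℤ.* ℤ.+ 1 ∎))))
  (fromℚᵘ-homo-+ (ℚᵘ.mkℚᵘ (ℤ.+ m) 0) (ℚᵘ.mkℚᵘ (ℤ.+ k) 0))
  where open ≡-Reasoning

divℚ-*-cancelˡ : ∀ d m .{{_ : NonZero d}} → divℚ (d ℕ.* m) d ≡ ι m
divℚ-*-cancelˡ (suc d) m = ℚP.fromℚᵘ-cong {ℚᵘ.mkℚᵘ (ℤ.+ (suc d ℕ.* m)) d} {ℚᵘ.mkℚᵘ (ℤ.+ m) 0}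
  (ℚᵘ.*≡* (begin
    ℤ.+ (suc d ℕ.* m) ℤ.* ℤ.+ 1 ≡⟨ ℤP.*-identityʳ _ ⟩
    ℤ.+ (suc d ℕ.* m)           ≡⟨ ℤP.pos-* (suc d) m ⟩
    ℤ.+ suc d ℤ.* ℤ.+ m         ≡⟨ ℤP.*-comm (ℤ.+ suc d) (ℤ.+ m) ⟩
    ℤ.+ m ℤ.* ℤ.+ suc d         ∎))
  where open ≡-Reasoning

divℚ-*-ι : ∀ m d → divℚ m (suc d) ≡ divℚ 1 (suc d) * ι m
divℚ-*-ι m d = sym (trans
  (sym (fromℚᵘ-homo-* (ℚᵘ.mkℚᵘ (ℤ.+ 1) d) (ℚᵘ.mkℚᵘ (ℤ.+ m) 0)))
  (ℚP.fromℚᵘ-cong {ℚᵘ.mkℚᵘ (ℤ.+ 1) d ℚᵘ.* ℚᵘ.mkℚᵘ (ℤ.+ m) 0} {ℚᵘ.mkℚᵘ (ℤ.+ m) d}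
    (ℚᵘ.*≡* (trans (cong (ℤ._* ℤ.+ suc d) (ℤP.*-identityˡ (ℤ.+ m)))
      (cong (λ t → ℤ.+ m ℤ.* ℤ.+ t) (sym (ℕP.*-identityʳ (suc d))))))))

ι-square-∸1 : ∀ q .{{_ : NonZero q}} → ι q * ι q - 1ℚ ≡ ι ((q ∸ 1) ℕ.* suc q)
ι-square-∸1 (suc r) = begin
  ι (suc r) * ι (suc r) - 1ℚ          ≡⟨ cong (_- 1ℚ) (sym (ι-homo-* (suc r) (suc r))) ⟩
  ι (suc r ℕ.* suc r) - 1ℚ            ≡⟨ cong (λ t → ι t - 1ℚ) (square-suc r) ⟩
  ι (r ℕ.* suc (suc r) ℕ.+ 1) - 1ℚ    ≡⟨ cong (_- 1ℚ) (ι-homo-+ (r ℕ.* suc (suc r)) 1) ⟩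
  ι (r ℕ.* suc (suc r)) + 1ℚ - 1ℚ     ≡⟨ add-sub (ι (r ℕ.* suc (suc r))) ⟩
  ι (r ℕ.* suc (suc r))               ∎
  where
  open ≡-Reasoning
  square-suc : ∀ r → suc r ℕ.* suc r ≡ r ℕ.* suc (suc r) ℕ.+ 1
  square-suc = ℕSolver.solve-∀
  add-sub : ∀ x → x + 1ℚ - 1ℚ ≡ x
  add-sub = solve-∀ ℚ-ring

sumℚ-++ : ∀ xs ys → sumℚ (xs ++ ys) ≡ sumℚ xs + sumℚ ys
sumℚ-++ List.[]       ys = sym (ℚP.+-identityˡ (sumℚ ys))
sumℚ-++ (x List.∷ xs) ys = trans (cong (x +_) (sumℚ-++ xs ys)) (sym (ℚP.+-assoc x (sumℚ xs) (sumℚ ys)))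

sumℚ-*ˡ : ∀ k xs → sumℚ (List.map (k *_) xs) ≡ k * sumℚ xs
sumℚ-*ˡ k List.[]       = sym (ℚP.*-zeroʳ k)
sumℚ-*ˡ k (x List.∷ xs) = trans (cong (k * x +_) (sumℚ-*ˡ k xs)) (sym (ℚP.*-distribˡ-+ k x (sumℚ xs)))

sumDivs : ∀ {n} → (Div n → ℚ) → ℚ
sumDivs {n} f = sumℚ (List.map f (allDivs n))

sumDivs-cong : ∀ {n} {f g : Div n → ℚ} → (∀ c → f c ≡ g c) → sumDivs f ≡ sumDivs g
sumDivs-cong {n} f≗g = cong sumℚ (map-cong f≗g (allDivs n))

sumDivs-*ˡ : ∀ {n} k (f : Div n → ℚ) → sumDivs (λ c → k * f c) ≡ k * sumDivs f
sumDivs-*ˡ {n} k f = trans (cong sumℚ (map-∘ (allDivs n))) (sumℚ-*ˡ k (List.map f (allDivs n)))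

sumDivs-∷ : ∀ {n} (f : Div (suc n) → ℚ) → sumDivs f ≡ sumDivs (f ∘ (true ∷_)) + sumDivs (f ∘ (false ∷_))
sumDivs-∷ {n} f = begin
  sumℚ (List.map f (List.map (true ∷_) ds ++ List.map (false ∷_) ds))
    ≡⟨ cong sumℚ (map-++ f (List.map (true ∷_) ds) (List.map (false ∷_) ds)) ⟩
  sumℚ (List.map f (List.map (true ∷_) ds) ++ List.map f (List.map (false ∷_) ds))
    ≡⟨ sumℚ-++ (List.map f (List.map (true ∷_) ds)) (List.map f (List.map (false ∷_) ds)) ⟩
  sumℚ (List.map f (List.map (true ∷_) ds)) + sumℚ (List.map f (List.map (false ∷_) ds))
    ≡⟨ sym (cong₂ _+_ (cong sumℚ (map-∘ ds)) (cong sumℚ (map-∘ ds))) ⟩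
  sumDivs (f ∘ (true ∷_)) + sumDivs (f ∘ (false ∷_)) ∎
  where
  open ≡-Reasoning
  ds = allDivs n

⊗-cong : ∀ {n} {M M′ K K′ : Mat n} → (∀ a b → M a b ≡ M′ a b) → (∀ a b → K a b ≡ K′ a b) →
         ∀ a b → (M ⊗ K) a b ≡ (M′ ⊗ K′) a b
⊗-cong M≗M′ K≗K′ a b = sumDivs-cong (λ c → cong₂ _*_ (M≗M′ a c) (K≗K′ c b))

⊗-scalˡ : ∀ {n} k (M K : Mat n) a b → (scal k M ⊗ K) a b ≡ k * (M ⊗ K) a b
⊗-scalˡ k M K a b = trans (sumDivs-cong (λ c → ℚP.*-assoc k (M a c) (K c b))) (sumDivs-*ˡ k (λ c → M a c * K c b))

⊗-scalʳ : ∀ {n} k (M K : Mat n) a b → (M ⊗ scal k K) a b ≡ k * (M ⊗ K) a b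
⊗-scalʳ k M K a b = trans (sumDivs-cong (λ c → x∙yz≈y∙xz (M a c) k (K c b))) (sumDivs-*ˡ k (λ c → M a c * K c b))

Mat₂ : Set
Mat₂ = Bool → Bool → ℚ

_⊗₂_ : Mat₂ → Mat₂ → Mat₂
(M ⊗₂ K) x y = M x true * K true y + M x false * K false y

-- The test not (x xor y) is the coordinate of x ⊞ y, so that val p (a ⊞ b) and AMat
-- factor coordinatewise into circ₂'s.
circ₂ : ℚ → ℚ → Mat₂
circ₂ d o x y = if not (x xor y) then d else o

circ₂-⊗₂-neg : ∀ d e x y → (circ₂ d e ⊗₂ circ₂ d (- e)) x y ≡ circ₂ (d * d - e * e) 0ℚ x y
circ₂-⊗₂-neg d e true  true  = diagonal d e
  where
  diagonal : ∀ d e → d * d + e * (- e) ≡ d * d - e * e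
  diagonal = solve-∀ ℚ-ring
circ₂-⊗₂-neg d e true  false = off-diagonal d e
  where
  off-diagonal : ∀ d e → d * (- e) + e * d ≡ 0ℚ
  off-diagonal = solve-∀ ℚ-ring
circ₂-⊗₂-neg d e false true  = off-diagonal d e
  where
  off-diagonal : ∀ d e → e * d + d * (- e) ≡ 0ℚ
  off-diagonal = solve-∀ ℚ-ring
circ₂-⊗₂-neg d e false false = diagonal d e
  where
  diagonal : ∀ d e → e * (- e) + d * d ≡ d * d - e * e
  diagonal = solve-∀ ℚ-ring

kron : ∀ {n} → (Fin n → Mat₂) → Mat n
kron M []      []      = 1ℚ
kron M (x ∷ a) (y ∷ b) = M zero x y * kron (M ∘ suc) a b

kron-cong : ∀ {n} {M K : Fin n → Mat₂} → (∀ i x y → M i x y ≡ K i x y) → ∀ a b → kron M a b ≡ kron K a b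
kron-cong M≗K []      []      = refl
kron-cong M≗K (x ∷ a) (y ∷ b) = cong₂ _*_ (M≗K zero x y) (kron-cong (M≗K ∘ suc) a b)

kron-⊗ : ∀ {n} (M K : Fin n → Mat₂) a b → (kron M ⊗ kron K) a b ≡ kron (λ i → M i ⊗₂ K i) a b
kron-⊗ M K []      []      = refl
kron-⊗ M K (x ∷ a) (y ∷ b) = begin
  sumDivs (λ c → kron M (x ∷ a) c * kron K c (y ∷ b))   ≡⟨ sumDivs-∷ (λ c → kron M (x ∷ a) c * kron K c (y ∷ b)) ⟩
  sumDivs (column true) + sumDivs (column false)       ≡⟨ cong₂ _+_ (sum-column true) (sum-column false) ⟩
  corner true * S + corner false * S                    ≡⟨ sym (ℚP.*-distribʳ-+ S (corner true) (corner false)) ⟩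
  (M zero ⊗₂ K zero) x y * S                            ≡⟨ cong ((M zero ⊗₂ K zero) x y *_) (kron-⊗ (M ∘ suc) (K ∘ suc) a b) ⟩
  kron (λ i → M i ⊗₂ K i) (x ∷ a) (y ∷ b)               ∎
  where
  open ≡-Reasoning
  column : Bool → Div _ → ℚ
  column t c = kron M (x ∷ a) (t ∷ c) * kron K (t ∷ c) (y ∷ b)
  corner : Bool → ℚ
  corner t = M zero x t * K zero t y
  S = (kron (M ∘ suc) ⊗ kron (K ∘ suc)) a b
  sum-column : ∀ t → sumDivs (column t) ≡ corner t * S
  sum-column t = trans
    (sumDivs-cong (λ c → interchange (M zero x t) (kron (M ∘ suc) a c) (K zero t y) (kron (K ∘ suc) c b)))
    (sumDivs-*ˡ (corner t) (λ c → kron (M ∘ suc) a c * kron (K ∘ suc) c b))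

idMat-refl : ∀ {n} (a : Div n) → idMat a a ≡ 1ℚ
idMat-refl a with ≡-dec BoolP._≟_ a a
... | yes _   = refl
... | no  a≢a = ⊥-elim (a≢a refl)

idMat-≢ : ∀ {n} {a b : Div n} → a ≢ b → idMat a b ≡ 0ℚ
idMat-≢ {a = a} {b} a≢b with ≡-dec BoolP._≟_ a b
... | yes a≡b = ⊥-elim (a≢b a≡b)
... | no  _   = refl

idMat-∷ : ∀ {n} x (a b : Div n) → idMat (x ∷ a) (x ∷ b) ≡ idMat a b
idMat-∷ {n} x a b = by-cases a b (≡-dec BoolP._≟_ a b)
  where
  by-cases : ∀ (a b : Div n) → Dec (a ≡ b) → idMat (x ∷ a) (x ∷ b) ≡ idMat a b
  by-cases a .a (yes refl) = trans (idMat-refl (x ∷ a)) (sym (idMat-refl a))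
  by-cases a b  (no a≢b)   = trans (idMat-≢ {a = x ∷ a} {x ∷ b} (a≢b ∘ ∷-injectiveʳ)) (sym (idMat-≢ a≢b))

circ₂-diagonal-idMat-∷ : ∀ {n} d c x y (a b : Div n) →
  circ₂ d 0ℚ x y * (c * idMat a b) ≡ d * c * idMat (x ∷ a) (y ∷ b)
circ₂-diagonal-idMat-∷ d c true  true  a b = trans (sym (ℚP.*-assoc d c (idMat a b))) (cong (d * c *_) (sym (idMat-∷ true a b)))
circ₂-diagonal-idMat-∷ d c false false a b = trans (sym (ℚP.*-assoc d c (idMat a b))) (cong (d * c *_) (sym (idMat-∷ false a b)))
circ₂-diagonal-idMat-∷ d c true  false a b =
  trans (ℚP.*-zeroˡ (c * idMat a b)) (sym (trans (cong (d * c *_) (idMat-≢ {a = true ∷ a} {false ∷ b} λ ())) (ℚP.*-zeroʳ (d * c))))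
circ₂-diagonal-idMat-∷ d c false true  a b =
  trans (ℚP.*-zeroˡ (c * idMat a b)) (sym (trans (cong (d * c *_) (idMat-≢ {a = false ∷ a} {true ∷ b} λ ())) (ℚP.*-zeroʳ (d * c))))

kron-circ₂-diagonal : ∀ {n} (k : Fin n → ℕ) a b → kron (λ i → circ₂ (ι (k i)) 0ℚ) a b ≡ ι (prodF k) * idMat a b
kron-circ₂-diagonal k []      []      = refl
kron-circ₂-diagonal k (x ∷ a) (y ∷ b) = begin
  circ₂ (ι (k zero)) 0ℚ x y * kron (λ i → circ₂ (ι (k (suc i))) 0ℚ) a b
    ≡⟨ cong (circ₂ (ι (k zero)) 0ℚ x y *_) (kron-circ₂-diagonal (k ∘ suc) a b) ⟩
  circ₂ (ι (k zero)) 0ℚ x y * (ι (prodF (k ∘ suc)) * idMat a b)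
    ≡⟨ circ₂-diagonal-idMat-∷ (ι (k zero)) (ι (prodF (k ∘ suc))) x y a b ⟩
  ι (k zero) * ι (prodF (k ∘ suc)) * idMat (x ∷ a) (y ∷ b)
    ≡⟨ cong (_* idMat (x ∷ a) (y ∷ b)) (sym (ι-homo-* (k zero) (prodF (k ∘ suc)))) ⟩
  ι (prodF k) * idMat (x ∷ a) (y ∷ b) ∎
  where open ≡-Reasoning

pick : ℕ → Bool → ℕ
pick q x = if x then q else 1

_∧v_ : ∀ {n} → Div n → Div n → Div n
a ∧v b = zipWith _∧_ a b

val-nonZero : ∀ {n} (p : Fin n → ℕ) → (∀ i → NonZero (p i)) → ∀ a → NonZero (val p a)
val-nonZero p p≢0 []      = _
val-nonZero p p≢0 (x ∷ a) = ℕP.m*n≢0 (pick (p zero) x) (val (p ∘ suc) a)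
  {{pick-nonZero x}} {{val-nonZero (p ∘ suc) (p≢0 ∘ suc) a}}
  where
  pick-nonZero : ∀ x → NonZero (pick (p zero) x)
  pick-nonZero true  = p≢0 zero
  pick-nonZero false = _

prodF-* : ∀ {n} (f g : Fin n → ℕ) → prodF (λ i → f i ℕ.* g i) ≡ prodF f ℕ.* prodF g
prodF-* {zero}  f g = refl
prodF-* {suc n} f g = trans (cong (f zero ℕ.* g zero ℕ.*_) (prodF-* (f ∘ suc) (g ∘ suc)))
  (ℕ-interchange (f zero) (g zero) (prodF (f ∘ suc)) (prodF (g ∘ suc)))

val-*-complement : ∀ {n} (p : Fin n → ℕ) a → val p a ℕ.* val p (map not a) ≡ prodF p
val-*-complement p []      = refl
val-*-complement p (x ∷ a) = begin
  pick q x ℕ.* val (p ∘ suc) a ℕ.* (pick q (not x) ℕ.* val (p ∘ suc) (map not a))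
    ≡⟨ ℕ-interchange (pick q x) (val (p ∘ suc) a) (pick q (not x)) (val (p ∘ suc) (map not a)) ⟩
  pick q x ℕ.* pick q (not x) ℕ.* (val (p ∘ suc) a ℕ.* val (p ∘ suc) (map not a))
    ≡⟨ cong₂ ℕ._*_ (pick-*-not x) (val-*-complement (p ∘ suc) a) ⟩
  q ℕ.* prodF (p ∘ suc) ∎
  where
  open ≡-Reasoning
  q = p zero
  pick-*-not : ∀ x → pick q x ℕ.* pick q (not x) ≡ q
  pick-*-not true  = ℕP.*-identityʳ q
  pick-*-not false = ℕP.*-identityˡ q

val-∧-complement : ∀ {n} (p : Fin n → ℕ) a → val p (a ∧v map not a) ≡ 1
val-∧-complement p []          = refl
val-∧-complement p (true ∷ a)  = trans (ℕP.*-identityˡ _) (val-∧-complement (p ∘ suc) a)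
val-∧-complement p (false ∷ a) = trans (ℕP.*-identityˡ _) (val-∧-complement (p ∘ suc) a)

val-∧-square : ∀ {n} (p : Fin n → ℕ) a b →
  prodF p ℕ.* (val p (a ∧v b) ℕ.* val p (a ∧v b)) ≡ val p a ℕ.* val p b ℕ.* val p (a ⊞ b)
val-∧-square p []      []      = refl
val-∧-square p (x ∷ a) (y ∷ b) = begin
  q ℕ.* P ℕ.* (h ℕ.* G ℕ.* (h ℕ.* G))             ≡⟨ regroupˡ q P h G ⟩
  q ℕ.* (h ℕ.* h) ℕ.* (P ℕ.* (G ℕ.* G))           ≡⟨ cong₂ ℕ._*_ (pick-square x y) (val-∧-square (p ∘ suc) a b) ⟩
  pick q x ℕ.* pick q y ℕ.* pick q (not (x xor y)) ℕ.* (A ℕ.* B ℕ.* F)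
    ≡⟨ regroupʳ (pick q x) (pick q y) (pick q (not (x xor y))) A B F ⟩
  pick q x ℕ.* A ℕ.* (pick q y ℕ.* B) ℕ.* (pick q (not (x xor y)) ℕ.* F) ∎
  where
  open ≡-Reasoning
  q = p zero
  P = prodF (p ∘ suc)
  h = pick q (x ∧ y)
  G = val (p ∘ suc) (a ∧v b)
  A = val (p ∘ suc) a
  B = val (p ∘ suc) b
  F = val (p ∘ suc) (a ⊞ b)
  regroupˡ : ∀ q P h G → q ℕ.* P ℕ.* (h ℕ.* G ℕ.* (h ℕ.* G)) ≡ q ℕ.* (h ℕ.* h) ℕ.* (P ℕ.* (G ℕ.* G))
  regroupˡ = ℕSolver.solve-∀
  regroupʳ : ∀ e f g A B F → e ℕ.* f ℕ.* g ℕ.* (A ℕ.* B ℕ.* F) ≡ e ℕ.* A ℕ.* (f ℕ.* B) ℕ.* (g ℕ.* F)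
  regroupʳ = ℕSolver.solve-∀
  pick-square : ∀ x y → q ℕ.* (pick q (x ∧ y) ℕ.* pick q (x ∧ y)) ≡ pick q x ℕ.* pick q y ℕ.* pick q (not (x xor y))
  pick-square true  true  = sym (ℕP.*-assoc q q q)
  pick-square true  false = sym (ℕP.*-identityʳ (q ℕ.* 1))
  pick-square false true  = cong (ℕ._* 1) (sym (ℕP.*-identityˡ q))
  pick-square false false = trans (ℕP.*-identityʳ q) (sym (ℕP.*-identityˡ q))

prime≢⇒coprime : ∀ {p q} → Prime p → Prime q → p ≢ q → Coprime p q
prime≢⇒coprime pp pq p≢q (d∣p , d∣q) with prime⇒irreducible pp d∣p
... | inj₁ d≡1 = d≡1
... | inj₂ refl with prime⇒irreducible pq d∣q
...   | inj₁ p≡1 = ⊥-elim (ℕ.nonTrivial⇒≢1 {{prime⇒nonTrivial pp}} p≡1)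
...   | inj₂ p≡q = ⊥-elim (p≢q p≡q)

coprime-* : ∀ {q m n} → Coprime q m → Coprime q n → Coprime q (m ℕ.* n)
coprime-* q⊥m q⊥n (d∣q , d∣mn) =
  q⊥n (d∣q , coprime-divisor (λ (e∣d , e∣m) → q⊥m (∣-trans e∣d d∣q , e∣m)) d∣mn)

coprime-val : ∀ {n q} (p : Fin n → ℕ) → Prime q → (∀ i → Prime (p i)) → (∀ i → q ≢ p i) →
              ∀ a → Coprime q (val p a)
coprime-val {q = q} p pq pp q≢p []      = Coprimality.sym (1-coprimeTo q)
coprime-val {q = q} p pq pp q≢p (x ∷ a) =
  coprime-* (coprime-pick x) (coprime-val (p ∘ suc) pq (pp ∘ suc) (q≢p ∘ suc) a)
  where
  coprime-pick : ∀ x → Coprime q (pick (p zero) x)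
  coprime-pick true  = prime≢⇒coprime pq (pp zero) (q≢p zero)
  coprime-pick false = Coprimality.sym (1-coprimeTo q)

gcd-*ˡ-coprime : ∀ {c} m n → Coprime c n → gcd (c ℕ.* m) n ≡ gcd m n
gcd-*ˡ-coprime {c} m n c⊥n = ∣-antisym
  (gcd-greatest (coprime-divisor g⊥c (gcd[m,n]∣m (c ℕ.* m) n)) (gcd[m,n]∣n (c ℕ.* m) n))
  (gcd-greatest (∣-trans (gcd[m,n]∣m m n) (n∣m*n c)) (gcd[m,n]∣n m n))
  where
  g⊥c : Coprime (gcd (c ℕ.* m) n) c
  g⊥c (d∣g , d∣c) = c⊥n (d∣c , ∣-trans d∣g (gcd[m,n]∣n (c ℕ.* m) n))

gcd-pick : ∀ {q} m n → Coprime q m → Coprime q n →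
           ∀ x y → gcd (pick q x ℕ.* m) (pick q y ℕ.* n) ≡ pick q (x ∧ y) ℕ.* gcd m n
gcd-pick {q} m n q⊥m q⊥n true  true  = sym (c*gcd[m,n]≡gcd[cm,cn] q m n)
gcd-pick {q} m n q⊥m q⊥n true  false = begin
  gcd (q ℕ.* m) (1 ℕ.* n) ≡⟨ cong (gcd (q ℕ.* m)) (ℕP.*-identityˡ n) ⟩
  gcd (q ℕ.* m) n         ≡⟨ gcd-*ˡ-coprime m n q⊥n ⟩
  gcd m n                 ≡⟨ sym (ℕP.*-identityˡ (gcd m n)) ⟩
  1 ℕ.* gcd m n           ∎
  where open ≡-Reasoning
gcd-pick {q} m n q⊥m q⊥n false true  = begin
  gcd (1 ℕ.* m) (q ℕ.* n) ≡⟨ gcd-comm (1 ℕ.* m) (q ℕ.* n) ⟩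
  gcd (q ℕ.* n) (1 ℕ.* m) ≡⟨ gcd-pick n m q⊥n q⊥m true false ⟩
  1 ℕ.* gcd n m           ≡⟨ cong (1 ℕ.*_) (gcd-comm n m) ⟩
  1 ℕ.* gcd m n           ∎
  where open ≡-Reasoning
gcd-pick {q} m n q⊥m q⊥n false false = begin
  gcd (1 ℕ.* m) (1 ℕ.* n) ≡⟨ cong₂ gcd (ℕP.*-identityˡ m) (ℕP.*-identityˡ n) ⟩
  gcd m n                 ≡⟨ sym (ℕP.*-identityˡ (gcd m n)) ⟩
  1 ℕ.* gcd m n           ∎
  where open ≡-Reasoning

gcd-val : ∀ {n} (p : Fin n → ℕ) → (∀ i → Prime (p i)) → (∀ i j → p i ≡ p j → i ≡ j) →
          ∀ a b → gcd (val p a) (val p b) ≡ val p (a ∧v b)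
gcd-val p pp p-inj []      []      = refl
gcd-val p pp p-inj (x ∷ a) (y ∷ b) = trans
  (gcd-pick (val (p ∘ suc) a) (val (p ∘ suc) b) (coprime-tail a) (coprime-tail b) x y)
  (cong (pick (p zero) (x ∧ y) ℕ.*_) (gcd-val (p ∘ suc) (pp ∘ suc) p∘suc-inj a b))
  where
  p∘suc-inj : ∀ i j → p (suc i) ≡ p (suc j) → i ≡ j
  p∘suc-inj i j e = suc-injective (p-inj (suc i) (suc j) e)
  head≢tail : ∀ i → p zero ≢ p (suc i)
  head≢tail i e with p-inj zero (suc i) e
  ... | ()
  coprime-tail : ∀ c → Coprime (p zero) (val (p ∘ suc) c)
  coprime-tail = coprime-val (p ∘ suc) (pp zero) (pp ∘ suc) head≢tail

divℕ-*-cancelˡ : ∀ m k .{{_ : NonZero m}} → divℕ (m ℕ.* k) m ≡ k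
divℕ-*-cancelˡ (suc m) k = trans (cong (ℕ._/ suc m) (ℕP.*-comm (suc m) k)) (m*n/n≡m k (suc m))

aN-val : ∀ {n} (p : Fin n → ℕ) → (∀ i → Prime (p i)) → (∀ i j → p i ≡ p j → i ≡ j) →
         ∀ a b → aN (prodF p) (val p a) (val p b) ≡ ι (val p (a ⊞ b))
aN-val p pp p-inj a b = begin
  divℚ (prodF p ℕ.* (gcd va vb ℕ.* gcd va vb)) (gcd va (divℕ (prodF p) va) ℕ.* (va ℕ.* vb))
    ≡⟨ cong₂ divℚ numerator denominator ⟩
  divℚ (va ℕ.* vb ℕ.* val p (a ⊞ b)) (va ℕ.* vb)
    ≡⟨ divℚ-*-cancelˡ (va ℕ.* vb) (val p (a ⊞ b)) {{ℕP.m*n≢0 va vb}} ⟩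
  ι (val p (a ⊞ b)) ∎
  where
  open ≡-Reasoning
  va = val p a
  vb = val p b
  instance
    p≢0 : ∀ {i} → NonZero (p i)
    p≢0 {i} = prime⇒nonZero (pp i)
    val≢0 : ∀ {c} → NonZero (val p c)
    val≢0 {c} = val-nonZero p (λ _ → p≢0) c
  numerator : prodF p ℕ.* (gcd va vb ℕ.* gcd va vb) ≡ va ℕ.* vb ℕ.* val p (a ⊞ b)
  numerator = trans (cong (λ g → prodF p ℕ.* (g ℕ.* g)) (gcd-val p pp p-inj a b)) (val-∧-square p a b)
  complement : divℕ (prodF p) va ≡ val p (map not a)
  complement = trans (cong (λ t → divℕ t va) (sym (val-*-complement p a))) (divℕ-*-cancelˡ va _)
  denominator : gcd va (divℕ (prodF p) va) ℕ.* (va ℕ.* vb) ≡ va ℕ.* vb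
  denominator = begin
    gcd va (divℕ (prodF p) va) ℕ.* (va ℕ.* vb) ≡⟨ cong (λ t → gcd va t ℕ.* (va ℕ.* vb)) complement ⟩
    gcd va (val p (map not a)) ℕ.* (va ℕ.* vb) ≡⟨ cong (ℕ._* (va ℕ.* vb)) (gcd-val p pp p-inj a (map not a)) ⟩
    val p (a ∧v map not a) ℕ.* (va ℕ.* vb)     ≡⟨ cong (ℕ._* (va ℕ.* vb)) (val-∧-complement p a) ⟩
    1 ℕ.* (va ℕ.* vb)                          ≡⟨ ℕP.*-identityˡ (va ℕ.* vb) ⟩
    va ℕ.* vb                                  ∎

ι-val-⊞ : ∀ {n} (p : Fin n → ℕ) a b → ι (val p (a ⊞ b)) ≡ kron (λ i → circ₂ (ι (p i)) 1ℚ) a b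
ι-val-⊞ p []      []      = refl
ι-val-⊞ p (x ∷ a) (y ∷ b) = trans (ι-homo-* (pick (p zero) (not (x xor y))) (val (p ∘ suc) (a ⊞ b)))
  (cong₂ _*_ (BoolP.if-float ι (not (x xor y))) (ι-val-⊞ (p ∘ suc) a b))

Λ-kron : ∀ {n} (p : Fin n → ℕ) → (∀ i → Prime (p i)) → (∀ i j → p i ≡ p j → i ≡ j) →
         ∀ a b → Λ p a b ≡ scal (divℚ 1 24) (kron (λ i → circ₂ (ι (p i)) 1ℚ)) a b
Λ-kron p pp p-inj a b = cong (divℚ 1 24 *_) (trans (aN-val p pp p-inj a b) (ι-val-⊞ p a b))

ω≤n : ∀ {n} (c : Div n) → ω c ℕ.≤ n
ω≤n []          = ℕ.z≤n
ω≤n (true ∷ c)  = ℕ.s≤s (ω≤n c)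
ω≤n (false ∷ c) = ℕP.m≤n⇒m≤1+n (ω≤n c)

sgn-false∷ : ∀ {n} (c : Div n) → sgn (false ∷ c) ≡ - sgn c
sgn-false∷ c = cong negPow (ℕP.+-∸-assoc 1 (ω≤n c))

sgn-∷-*-ι-pick : ∀ {n} q e (c : Div n) v →
  sgn (e ∷ c) * ι (pick q e ℕ.* v) ≡ (if e then ι q else - 1ℚ) * (sgn c * ι v)
sgn-∷-*-ι-pick q true  c v = trans (cong (sgn c *_) (ι-homo-* q v)) (x∙yz≈y∙xz (sgn c) (ι q) (ι v))
sgn-∷-*-ι-pick q false c v =
  trans (cong₂ _*_ (sgn-false∷ c) (cong ι (ℕP.*-identityˡ v))) (neg-* (sgn c) (ι v))
  where
  neg-* : ∀ s t → - s * t ≡ - 1ℚ * (s * t)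
  neg-* = solve-∀ ℚ-ring

AMat-kron : ∀ {n} (p : Fin n → ℕ) a b → AMat p a b ≡ kron (λ i → circ₂ (ι (p i)) (- 1ℚ)) a b
AMat-kron p []      []      = refl
AMat-kron p (x ∷ a) (y ∷ b) =
  trans (sgn-∷-*-ι-pick (p zero) (not (x xor y)) (a ⊞ b) (val (p ∘ suc) (a ⊞ b)))
        (cong (circ₂ (ι (p zero)) (- 1ℚ) x y *_) (AMat-kron (p ∘ suc) a b))

kron-circ₂-inverse : ∀ {n} (p : Fin n → ℕ) .{{_ : ∀ {i} → NonZero (p i)}} e → e * e ≡ 1ℚ → ∀ a b →
  (kron (λ i → circ₂ (ι (p i)) e) ⊗ kron (λ i → circ₂ (ι (p i)) (- e))) a b ≡ ι (φN p ℕ.* ψN p) * idMat a b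
kron-circ₂-inverse p e e²≡1 a b = begin
  (kron (λ i → circ₂ (ι (p i)) e) ⊗ kron (λ i → circ₂ (ι (p i)) (- e))) a b
    ≡⟨ kron-⊗ (λ i → circ₂ (ι (p i)) e) (λ i → circ₂ (ι (p i)) (- e)) a b ⟩
  kron (λ i → circ₂ (ι (p i)) e ⊗₂ circ₂ (ι (p i)) (- e)) a b
    ≡⟨ kron-cong block a b ⟩
  kron (λ i → circ₂ (ι ((p i ∸ 1) ℕ.* suc (p i))) 0ℚ) a b
    ≡⟨ kron-circ₂-diagonal (λ i → (p i ∸ 1) ℕ.* suc (p i)) a b ⟩
  ι (prodF (λ i → (p i ∸ 1) ℕ.* suc (p i))) * idMat a b
    ≡⟨ cong (λ t → ι t * idMat a b) (prodF-* (λ i → p i ∸ 1) (λ i → suc (p i))) ⟩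
  ι (φN p ℕ.* ψN p) * idMat a b ∎
  where
  open ≡-Reasoning
  block : ∀ i x y → (circ₂ (ι (p i)) e ⊗₂ circ₂ (ι (p i)) (- e)) x y ≡ circ₂ (ι ((p i ∸ 1) ℕ.* suc (p i))) 0ℚ x y
  block i x y = trans (circ₂-⊗₂-neg (ι (p i)) e x y)
    (cong (λ d → circ₂ d 0ℚ x y) (trans (cong (λ t → ι (p i) * ι (p i) - t) e²≡1) (ι-square-∸1 (p i))))

lemma3p5 : (n : ℕ) (p : Fin n → ℕ) → (∀ i → Prime (p i)) → (∀ i j → p i ≡ p j → i ≡ j) →
    let c = divℚ (φN p Data.Nat.* ψN p) 24 in
    (∀ a b → (Λ p ⊗ AMat p) a b ≡ scal c idMat a b) × (∀ a b → (AMat p ⊗ Λ p) a b ≡ scal c idMat a b)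
lemma3p5 n p pp p-inj = Λ⊗A , A⊗Λ
  where
  open ≡-Reasoning
  instance
    p≢0 : ∀ {i} → NonZero (p i)
    p≢0 {i} = prime⇒nonZero (pp i)
  L R : Fin n → Mat₂
  L i = circ₂ (ι (p i)) 1ℚ
  R i = circ₂ (ι (p i)) (- 1ℚ)
  M = φN p ℕ.* ψN p
  rescale : ∀ a b → divℚ 1 24 * (ι M * idMat a b) ≡ divℚ M 24 * idMat a b
  rescale a b = trans (sym (ℚP.*-assoc (divℚ 1 24) (ι M) (idMat a b))) (cong (_* idMat a b) (sym (divℚ-*-ι M 23)))
  Λ⊗A : ∀ a b → (Λ p ⊗ AMat p) a b ≡ divℚ M 24 * idMat a b
  Λ⊗A a b = begin
    (Λ p ⊗ AMat p) a b                     ≡⟨ ⊗-cong (Λ-kron p pp p-inj) (AMat-kron p) a b ⟩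
    (scal (divℚ 1 24) (kron L) ⊗ kron R) a b ≡⟨ ⊗-scalˡ (divℚ 1 24) (kron L) (kron R) a b ⟩
    divℚ 1 24 * (kron L ⊗ kron R) a b      ≡⟨ cong (divℚ 1 24 *_) (kron-circ₂-inverse p 1ℚ refl a b) ⟩
    divℚ 1 24 * (ι M * idMat a b)          ≡⟨ rescale a b ⟩
    divℚ M 24 * idMat a b                  ∎
  A⊗Λ : ∀ a b → (AMat p ⊗ Λ p) a b ≡ divℚ M 24 * idMat a b
  A⊗Λ a b = begin
    (AMat p ⊗ Λ p) a b                     ≡⟨ ⊗-cong (AMat-kron p) (Λ-kron p pp p-inj) a b ⟩
    (kron R ⊗ scal (divℚ 1 24) (kron L)) a b ≡⟨ ⊗-scalʳ (divℚ 1 24) (kron R) (kron L) a b ⟩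
    divℚ 1 24 * (kron R ⊗ kron L) a b      ≡⟨ cong (divℚ 1 24 *_) (kron-circ₂-inverse p (- 1ℚ) refl a b) ⟩
    divℚ 1 24 * (ι M * idMat a b)          ≡⟨ rescale a b ⟩
    divℚ M 24 * idMat a b                  ∎
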